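{- For every integer $n \ge 3$, the optimal pegging number of the path $P_n$ on $n$ vertices is $p(P_n)=\lceil n/2\rceil$.
   Context: $P_n$ is the path on $n$ vertices. A distribution of pegs on a graph $G$ is a subset $D \subseteq V(G)$. If $u,v \in D$ are distinct adjacent vertices and $w \notin D$ is a vertex adjacent to $v$, the pegging move (jumping $u$ over $v$ into $w$) replaces $D$ by $(D\setminus\{u,v\})\cup\{w\}$. A vertex $t$ is reachable from $D$ if some finite (possibly empty) sequence of pegging moves starting from $D$ ends in a distribution containing $t$; $\mathrm{Reach}(D)$ is the set of reachable vertices. The optimal pegging number $p(G)$ is the smallest positive integer $d$ such that some distribution of size $d$ on $G$ has reach $V(G)$. -}

module Defs where

open import Data.Nat using (ℕ; suc; _+_; _≤_; _<_; ⌈_/2⌉)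
open import Data.Nat.Properties using (1+n≢n)
open import Data.Fin using (Fin; toℕ)
open import Data.Fin.Subset using (Subset; _∈_; _∉_; ∣_∣; _─_; _∪_; ⁅_⁆)
open import Data.Product using (Σ; _×_; ∃)
open import Data.Sum using (_⊎_; inj₁; inj₂)
open import Relation.Binary.PropositionalEquality using (_≡_)
import Relation.Binary.PropositionalEquality
open import Relation.Nullary using (¬_)
open import Relation.Binary.Construct.Closure.ReflexiveTransitive using (Star)

record Graph (n : ℕ) : Set₁ where
  field
    Adj   : Fin n → Fin n → Set
    sym   : ∀ {u v} → Adj u v → Adj v u
    irrefl : ∀ {u} → ¬ Adj u u
open Graph public

Distribution : ℕ → Set
Distribution n = Subset n

data Move {n : ℕ} (G : Graph n) : Distribution n → Distribution n → Set where
  jump : ∀ {D} (u v w : Fin n) →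
         u ∈ D → v ∈ D → ¬ u ≡ v → Adj G u v →
         w ∉ D → Adj G v w →
         Move G D (((D ─ ⁅ u ⁆) ─ ⁅ v ⁆) ∪ ⁅ w ⁆)

Moves : ∀ {n} → Graph n → Distribution n → Distribution n → Set
Moves G = Star (Move G)

Reachable : ∀ {n} → Graph n → Distribution n → Fin n → Set
Reachable G D t = ∃ λ D′ → Moves G D D′ × t ∈ D′

FullReach : ∀ {n} → Graph n → Distribution n → Set
FullReach G D = ∀ t → Reachable G D t

IsOptimalPeggingNumber : ∀ {n} → Graph n → ℕ → Set
IsOptimalPeggingNumber G d =
  1 ≤ d
  × (∃ λ D → ∣ D ∣ ≡ d × FullReach G D)
  × (∀ d′ → 1 ≤ d′ → d′ < d → ∀ D → ∣ D ∣ ≡ d′ → ¬ FullReach G D)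

PathAdj : ∀ {n} → Fin n → Fin n → Set
PathAdj i j = suc (toℕ i) ≡ toℕ j ⊎ suc (toℕ j) ≡ toℕ i

PathAdj-sym : ∀ {n} {i j : Fin n} → PathAdj i j → PathAdj j i
PathAdj-sym (inj₁ p) = inj₂ p
PathAdj-sym (inj₂ p) = inj₁ p

PathAdj-irrefl : ∀ {n} {i : Fin n} → ¬ PathAdj i i
PathAdj-irrefl {i = i} (inj₁ p) = 1+n≢n p
PathAdj-irrefl {i = i} (inj₂ p) = 1+n≢n p

P : (n : ℕ) → Graph n
P n = record { Adj = PathAdj ; sym = PathAdj-sym ; irrefl = PathAdj-irrefl }

module Submission where

-- A cell is covered by a distribution if it holds a peg or lies in an interval that contains two
-- adjacent pegs but no two adjacent holes. Undoing a jump never uncovers a cell, so every reachable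
-- cell is covered. A left-to-right scan shows that covering all n cells of the path takes at least
-- n/2 pegs: every hole has to be paid for by a neighbouring peg, and two adjacent holes can only
-- occur right after an interval that already contains an adjacent pair, i.e. a peg to spare.
-- Conversely, pegs on cell 1 and on the even cells 2, 4, … reach everything: 2 jumps over 1 into 0,
-- and the peg on 1 leapfrogs over the even pegs into every odd cell.

open import Defs hiding (sym)
open import Data.Bool using (Bool; true; false; not; _∧_; _∨_; if_then_else_)
open import Data.Bool.Properties using (∧-zeroʳ; ∨-comm)
open import Data.Empty using (⊥; ⊥-elim)
open import Data.Fin using (Fin; toℕ; fromℕ<) renaming (zero to fzero; suc to fsuc)
open import Data.Fin.Properties using (toℕ-injective; toℕ-fromℕ<; toℕ<n)
open import Data.Fin.Subset using (Subset; _∈_; _∉_; ∣_∣; _─_; _∪_; ⁅_⁆) renaming (⊥ to ∅)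
open import Data.Fin.Subset.Properties using (x∈⁅x⁆)
open import Data.Nat
  using (ℕ; zero; suc; _+_; _∸_; _≤_; _<_; z≤n; s≤s; s≤s⁻¹; _≟_; _<?_; _≤?_; ⌈_/2⌉; ⌊_/2⌋)
open import Data.Nat.Properties
open import Data.Product using (_×_; _,_; ∃)
open import Data.Sum using (_⊎_; inj₁; inj₂)
open import Data.Vec using ([]; _∷_; here; there)
open import Function using (_∘_; id)
open import Relation.Binary.PropositionalEquality
open import Relation.Binary.Construct.Closure.ReflexiveTransitive using (ε; _◅_)
open import Relation.Binary.Definitions using (tri<; tri≈; tri>)
open import Relation.Nullary using (yes; no; contradiction)

-- Cells beyond the end of the path read as holes.
occupied : ∀ {n} → Subset n → ℕ → Bool
occupied []      _       = false
occupied (b ∷ p) zero    = b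
occupied (b ∷ p) (suc i) = occupied p i

∈⇒occupied : ∀ {n} {x : Fin n} {p : Subset n} → x ∈ p → occupied p (toℕ x) ≡ true
∈⇒occupied here        = refl
∈⇒occupied (there x∈p) = ∈⇒occupied x∈p

occupied⇒∈ : ∀ {n} (x : Fin n) (p : Subset n) → occupied p (toℕ x) ≡ true → x ∈ p
occupied⇒∈ fzero    (true ∷ p) refl = here
occupied⇒∈ (fsuc x) (b ∷ p)    h    = there (occupied⇒∈ x p h)

occupied-beyond : ∀ {n} (p : Subset n) {i} → n ≤ i → occupied p i ≡ false
occupied-beyond []      _         = refl
occupied-beyond (b ∷ p) (s≤s n≤i) = occupied-beyond p n≤i

occupied-∅ : ∀ {n} i → occupied (∅ {n}) i ≡ false
occupied-∅ {zero}  _       = refl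
occupied-∅ {suc n} zero    = refl
occupied-∅ {suc n} (suc i) = occupied-∅ {n} i

occupied-⁅⁆ : ∀ {n} (x : Fin n) {i} → i ≢ toℕ x → occupied ⁅ x ⁆ i ≡ false
occupied-⁅⁆         fzero    {zero}  i≢x = contradiction refl i≢x
occupied-⁅⁆ {suc n} fzero    {suc i} _   = occupied-∅ {n} i
occupied-⁅⁆         (fsuc x) {zero}  _   = refl
occupied-⁅⁆         (fsuc x) {suc i} i≢x = occupied-⁅⁆ x (i≢x ∘ cong suc)

occupied-∪ : ∀ {n} (p q : Subset n) i → occupied (p ∪ q) i ≡ occupied p i ∨ occupied q i
occupied-∪ []      []      _       = refl
occupied-∪ (_ ∷ _) (_ ∷ _) zero    = refl
occupied-∪ (_ ∷ p) (_ ∷ q) (suc i) = occupied-∪ p q i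

occupied-─ : ∀ {n} (p q : Subset n) i → occupied (p ─ q) i ≡ not (occupied q i) ∧ occupied p i
occupied-─ []      []          _       = refl
occupied-─ (_ ∷ _) (true ∷ _)  zero    = refl
occupied-─ (_ ∷ _) (false ∷ _) zero    = refl
occupied-─ (_ ∷ p) (_ ∷ q)     (suc i) = occupied-─ p q i

jumped : ∀ {n} → Subset n → Fin n → Fin n → Fin n → Subset n
jumped D u v w = ((D ─ ⁅ u ⁆) ─ ⁅ v ⁆) ∪ ⁅ w ⁆

module _ {n} (D : Subset n) (u v w : Fin n) where

  occupied-jump : ∀ i → occupied (jumped D u v w) i ≡
                  occupied ⁅ w ⁆ i ∨ (not (occupied ⁅ v ⁆ i) ∧ (not (occupied ⁅ u ⁆ i) ∧ occupied D i))
  occupied-jump i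
    rewrite occupied-∪ ((D ─ ⁅ u ⁆) ─ ⁅ v ⁆) ⁅ w ⁆ i
          | occupied-─ (D ─ ⁅ u ⁆) ⁅ v ⁆ i
          | occupied-─ D ⁅ u ⁆ i
    = ∨-comm _ (occupied ⁅ w ⁆ i)

  occupied-jumped-target : occupied (jumped D u v w) (toℕ w) ≡ true
  occupied-jumped-target rewrite occupied-jump (toℕ w) | ∈⇒occupied (x∈⁅x⁆ w) = refl

  occupied-jumped-u : toℕ u ≢ toℕ w → occupied (jumped D u v w) (toℕ u) ≡ false
  occupied-jumped-u u≢w
    rewrite occupied-jump (toℕ u) | occupied-⁅⁆ w u≢w | ∈⇒occupied (x∈⁅x⁆ u)
    = ∧-zeroʳ (not (occupied ⁅ v ⁆ (toℕ u)))

  occupied-jumped-v : toℕ v ≢ toℕ w → occupied (jumped D u v w) (toℕ v) ≡ false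
  occupied-jumped-v v≢w
    rewrite occupied-jump (toℕ v) | occupied-⁅⁆ w v≢w | ∈⇒occupied (x∈⁅x⁆ v) = refl

  occupied-jumped-⊆ : ∀ {i} → i ≢ toℕ w → occupied (jumped D u v w) i ≡ true → occupied D i ≡ true
  occupied-jumped-⊆ {i} i≢w h rewrite occupied-jump i | occupied-⁅⁆ w i≢w
    with occupied ⁅ v ⁆ i | occupied ⁅ u ⁆ i | h
  ... | false | false | D∋i = D∋i

  occupied-jumped-other : ∀ {i} → i ≢ toℕ u → i ≢ toℕ v → i ≢ toℕ w →
                          occupied (jumped D u v w) i ≡ occupied D i
  occupied-jumped-other {i} i≢u i≢v i≢w
    rewrite occupied-jump i | occupied-⁅⁆ w i≢w | occupied-⁅⁆ v i≢v | occupied-⁅⁆ u i≢u = refl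

peg≢hole : ∀ {b : Bool} → b ≡ true → b ≢ false
peg≢hole refl ()

Gapless : (ℕ → Bool) → ℕ → ℕ → Set
Gapless f a b = ∀ i → a ≤ i → i < b → f i ≡ true ⊎ f (suc i) ≡ true

record Span (f : ℕ → Bool) (a b : ℕ) : Set where
  constructor span
  field
    gapless : Gapless f a b
    pair    : ℕ
    a≤pair  : a ≤ pair
    pair<b  : pair < b
    pegˡ    : f pair ≡ true
    pegʳ    : f (suc pair) ≡ true

data Covered (f : ℕ → Bool) (x : ℕ) : Set where
  peg     : f x ≡ true → Covered f x
  spanned : ∀ {a b} → a ≤ x → x ≤ b → Span f a b → Covered f x

Outside : ℕ → ℕ → ℕ → Set
Outside w a b = w < a ⊎ b < w

Outside⇒≢ : ∀ {w a b i} → Outside w a b → a ≤ i → i ≤ b → i ≢ w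
Outside⇒≢ (inj₁ w<a) a≤i _   = >⇒≢ (<-≤-trans w<a a≤i)
Outside⇒≢ (inj₂ b<w) _   i≤b = <⇒≢ (≤-<-trans i≤b b<w)

Outside-or-within : ∀ w a b → Outside w a b ⊎ (a ≤ w × w ≤ b)
Outside-or-within w a b with w <? a | b <? w
... | yes w<a | _       = inj₁ (inj₁ w<a)
... | no _    | yes b<w = inj₁ (inj₂ b<w)
... | no w≮a  | no b≮w  = inj₂ (≮⇒≥ w≮a , ≮⇒≥ b≮w)

module _ {f : ℕ → Bool} where

  Gapless-empty : ∀ {a} → Gapless f a a
  Gapless-empty i a≤i i<a = contradiction a≤i (<⇒≱ i<a)

  Gapless-cons : ∀ {a b} → f a ≡ true ⊎ f (suc a) ≡ true → Gapless f (suc a) b → Gapless f a b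
  Gapless-cons {a} first gl i a≤i i<b with a ≟ i
  ... | yes refl = first
  ... | no a≢i   = gl i (≤∧≢⇒< a≤i a≢i) i<b

  Gapless-snoc : ∀ {a b} → Gapless f a b → f b ≡ true ⊎ f (suc b) ≡ true → Gapless f a (suc b)
  Gapless-snoc {b = b} gl last i a≤i i≤b with i ≟ b
  ... | yes refl = last
  ... | no i≢b   = gl i a≤i (≤∧≢⇒< (s≤s⁻¹ i≤b) i≢b)

  Gapless-window : ∀ {k} → f (suc k) ≡ true → Gapless f k (suc (suc k))
  Gapless-window mid = Gapless-cons (inj₂ mid) (Gapless-cons (inj₁ mid) Gapless-empty)

  Gapless-shrink : ∀ {a b c d} → Gapless f a b → a ≤ c → d ≤ b → Gapless f c d
  Gapless-shrink gl a≤c d≤b i c≤i i<d = gl i (≤-trans a≤c c≤i) (<-≤-trans i<d d≤b)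

  Gapless-hole² : ∀ {a b i} → Gapless f a b → a ≤ i → i < b →
                  f i ≡ false → f (suc i) ≡ false → ⊥
  Gapless-hole² gl a≤i i<b hole hole′ with gl _ a≤i i<b
  ... | inj₁ peg′ = peg≢hole peg′ hole
  ... | inj₂ peg′ = peg≢hole peg′ hole′

  Span-window : ∀ {k} → f (suc k) ≡ true → f k ≡ true ⊎ f (suc (suc k)) ≡ true →
                Span f k (suc (suc k))
  Span-window {k} mid (inj₁ left)  = span (Gapless-window mid) k       ≤-refl    (s≤s (n≤1+n k)) left mid
  Span-window {k} mid (inj₂ right) = span (Gapless-window mid) (suc k) (n≤1+n k) ≤-refl          mid right

  Covered-window : ∀ {k x} → f (suc k) ≡ true → f k ≡ true ⊎ f (suc (suc k)) ≡ true →
                   k ≤ x → x ≤ suc (suc k) → Covered f x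
  Covered-window mid end k≤x x≤k+2 = spanned k≤x x≤k+2 (Span-window mid end)

Span-shrink : ∀ {f a b c d} (S : Span f a b) →
              a ≤ c → c ≤ Span.pair S → Span.pair S < d → d ≤ b → Span f c d
Span-shrink (span gl p _ _ fp fp′) a≤c c≤p p<d d≤b = span (Gapless-shrink gl a≤c d≤b) p c≤p p<d fp fp′

module _ {f g : ℕ → Bool} {w : ℕ} (g⊆f : ∀ i → i ≢ w → g i ≡ true → f i ≡ true) where

  Gapless-away : ∀ {a b} → Outside w a b → Gapless g a b → Gapless f a b
  Gapless-away out gl i a≤i i<b with gl i a≤i i<b
  ... | inj₁ gi = inj₁ (g⊆f i       (Outside⇒≢ out a≤i (<⇒≤ i<b))       gi)
  ... | inj₂ gi = inj₂ (g⊆f (suc i) (Outside⇒≢ out (m≤n⇒m≤1+n a≤i) i<b) gi)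

  Span-away : ∀ {a b} → Outside w a b → Span g a b → Span f a b
  Span-away out (span gl p a≤p p<b gp gp′) =
    span (Gapless-away out gl) p a≤p p<b
         (g⊆f p       (Outside⇒≢ out a≤p (<⇒≤ p<b))       gp)
         (g⊆f (suc p) (Outside⇒≢ out (m≤n⇒m≤1+n a≤p) p<b) gp′)

Covered-reflect : ∀ {f g w} → (∀ i → i ≢ w → g i ≡ true → f i ≡ true) → Covered f w →
  (∀ {a b x} → Span g a b → a ≤ x → x ≤ b → a ≤ w → w ≤ b → Covered f x) →
  ∀ {x} → Covered g x → Covered f x
Covered-reflect {w = w} g⊆f fw straddle {x} (peg gx) with x ≟ w
... | yes refl = fw
... | no x≢w   = peg (g⊆f x x≢w gx)
Covered-reflect {w = w} g⊆f fw straddle (spanned {a} {b} a≤x x≤b S) with Outside-or-within w a b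
... | inj₁ out          = spanned a≤x x≤b (Span-away g⊆f out S)
... | inj₂ (a≤w , w≤b)  = straddle S a≤x x≤b a≤w w≤b

record JumpEffect (f g : ℕ → Bool) (u v w : ℕ) : Set where
  field
    u-before : f u ≡ true
    v-before : f v ≡ true
    u-after  : g u ≡ false
    v-after  : g v ≡ false
    after⊆before : ∀ i → i ≢ w → g i ≡ true → f i ≡ true

open JumpEffect

-- S cannot contain both holes k, k+1, so it starts at k+1 or k+2; before the jump the pegs on k, k+1
-- prolong it to the left when its pair sits at the landing cell.
Covered-straddleʳ : ∀ {f g k a b x} → JumpEffect f g k (suc k) (suc (suc k)) → Span g a b →
                    a ≤ x → x ≤ b → a ≤ suc (suc k) → suc (suc k) ≤ b → Covered f x
Covered-straddleʳ {f} {g} {k} {a} {b} {x} J S@(span gl p a≤p p<b gp gp′) a≤x x≤b a≤w w≤b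
  with a ≤? k | <-cmp p (suc (suc k))
... | yes a≤k | _ =
  ⊥-elim (Gapless-hole² gl a≤k (<-≤-trans (s≤s (n≤1+n k)) w≤b) (u-after J) (v-after J))
... | no a≰k | tri< p<w _ _ =
  ⊥-elim (peg≢hole (subst (λ i → g i ≡ true) (≤-antisym (s≤s⁻¹ p<w) (≤-trans (≰⇒> a≰k) a≤p)) gp)
                   (v-after J))
... | no a≰k | tri≈ _ refl _ =
  spanned (<⇒≤ (<-≤-trans (≰⇒> a≰k) a≤x)) x≤b
          (span gap k ≤-refl (<-≤-trans (s≤s (n≤1+n k)) w≤b) (u-before J) (v-before J))
  where
  gap : Gapless f k b
  gap = Gapless-cons (inj₁ (u-before J)) (Gapless-cons (inj₁ (v-before J))
          (Gapless-cons (inj₂ (after⊆before J _ 1+n≢n gp′))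
            (Gapless-away (after⊆before J) (inj₁ (n<1+n _))
              (Gapless-shrink gl (m≤n⇒m≤1+n a≤w) ≤-refl))))
... | no a≰k | tri> _ _ w<p with x ≤? suc (suc k)
...   | yes x≤w = Covered-window (v-before J) (inj₁ (u-before J)) (<⇒≤ (<-≤-trans (≰⇒> a≰k) a≤x)) x≤w
...   | no x≰w  = spanned (≰⇒> x≰w) x≤b (Span-away (after⊆before J) (inj₁ (n<1+n _))
                                          (Span-shrink S (m≤n⇒m≤1+n a≤w) w<p p<b ≤-refl))

Covered-straddleˡ : ∀ {f g k a b x} → JumpEffect f g (suc (suc k)) (suc k) k → Span g a b →
                    a ≤ x → x ≤ b → a ≤ k → k ≤ b → Covered f x
Covered-straddleˡ {f} {g} {k} {a} {b} {x} J S@(span gl p a≤p p<b gp gp′) a≤x x≤b a≤k k≤b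
  with suc k <? b | <-cmp (suc p) k
... | yes k+1<b | _ = ⊥-elim (Gapless-hole² gl (m≤n⇒m≤1+n a≤k) k+1<b (v-after J) (u-after J))
... | no k+1≮b | tri> _ _ k<p+1 =
  ⊥-elim (peg≢hole (subst (λ i → g i ≡ true) (≤-antisym (≤-trans p<b (≮⇒≥ k+1≮b)) k<p+1) gp′)
                   (v-after J))
... | no k+1≮b | tri≈ _ refl _ =
  spanned a≤x (≤-trans x≤b (≤-trans (≮⇒≥ k+1≮b) (n≤1+n _)))
          (span gap (suc (suc p)) (≤-trans a≤p (≤-trans (n≤1+n p) (n≤1+n _))) ≤-refl
                (v-before J) (u-before J))
  where
  gap : Gapless f a (suc (suc (suc p)))
  gap = Gapless-snoc (Gapless-snoc (Gapless-snoc
          (Gapless-away (after⊆before J) (inj₂ (n<1+n p)) (Gapless-shrink gl ≤-refl (<⇒≤ p<b)))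
          (inj₁ (after⊆before J p (<⇒≢ (n<1+n p)) gp)))
          (inj₂ (v-before J)))
          (inj₁ (v-before J))
... | no k+1≮b | tri< (s≤s p+1≤k′) _ _ with x <? suc _
...   | yes x<k = spanned a≤x (s≤s⁻¹ x<k) (Span-away (after⊆before J) (inj₂ (n<1+n _))
                                          (Span-shrink S ≤-refl a≤p p+1≤k′ (≤-trans (n≤1+n _) k≤b)))
...   | no x≮k  = Covered-window (v-before J) (inj₂ (u-before J)) (≮⇒≥ x≮k)
                                 (≤-trans x≤b (≤-trans (≮⇒≥ k+1≮b) (n≤1+n _)))

jump-direction : ∀ {u v w : ℕ} → (suc u ≡ v ⊎ suc v ≡ u) → (suc v ≡ w ⊎ suc w ≡ v) → u ≢ w →
                 (suc u ≡ v × suc v ≡ w) ⊎ (suc v ≡ u × suc w ≡ v)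
jump-direction (inj₁ uv) (inj₁ vw) _   = inj₁ (uv , vw)
jump-direction (inj₂ vu) (inj₂ wv) _   = inj₂ (vu , wv)
jump-direction (inj₁ uv) (inj₂ wv) u≢w = ⊥-elim (u≢w (suc-injective (trans uv (sym wv))))
jump-direction (inj₂ vu) (inj₁ vw) u≢w = ⊥-elim (u≢w (trans (sym vu) vw))

Covered-before-jump : ∀ {f g u v w} → JumpEffect f g u v w →
                      (suc u ≡ v × suc v ≡ w) ⊎ (suc v ≡ u × suc w ≡ v) →
                      ∀ {x} → Covered g x → Covered f x
Covered-before-jump J (inj₁ (refl , refl)) =
  Covered-reflect (after⊆before J)
    (Covered-window (v-before J) (inj₁ (u-before J)) (≤-trans (n≤1+n _) (n≤1+n _)) ≤-refl)
    (Covered-straddleʳ J)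
Covered-before-jump J (inj₂ (refl , refl)) =
  Covered-reflect (after⊆before J)
    (Covered-window (v-before J) (inj₂ (u-before J)) ≤-refl (≤-trans (n≤1+n _) (n≤1+n _)))
    (Covered-straddleˡ J)

∈∉⇒toℕ≢ : ∀ {n} {D : Subset n} {x y : Fin n} → x ∈ D → y ∉ D → toℕ x ≢ toℕ y
∈∉⇒toℕ≢ {D = D} x∈D y∉D x≡y = y∉D (subst (_∈ D) (toℕ-injective x≡y) x∈D)

jump-effect : ∀ {n} {D : Subset n} {u v w : Fin n} → u ∈ D → v ∈ D → w ∉ D →
              JumpEffect (occupied D) (occupied (jumped D u v w)) (toℕ u) (toℕ v) (toℕ w)
jump-effect {D = D} {u} {v} {w} u∈D v∈D w∉D = record
  { u-before     = ∈⇒occupied u∈D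
  ; v-before     = ∈⇒occupied v∈D
  ; u-after      = occupied-jumped-u D u v w (∈∉⇒toℕ≢ u∈D w∉D)
  ; v-after      = occupied-jumped-v D u v w (∈∉⇒toℕ≢ v∈D w∉D)
  ; after⊆before = λ _ → occupied-jumped-⊆ D u v w
  }

Covered-before-move : ∀ {n} {D D′ : Subset n} → Move (P n) D D′ →
                      ∀ {x} → Covered (occupied D′) x → Covered (occupied D) x
Covered-before-move (jump u v w u∈D v∈D _ u~v w∉D v~w) =
  Covered-before-jump (jump-effect u∈D v∈D w∉D) (jump-direction u~v v~w (∈∉⇒toℕ≢ u∈D w∉D))

Covered-before-moves : ∀ {n} {D D′ : Subset n} → Moves (P n) D D′ →
                       ∀ {x} → Covered (occupied D′) x → Covered (occupied D) x
Covered-before-moves ε        = id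
Covered-before-moves (m ◅ ms) = Covered-before-move m ∘ Covered-before-moves ms

Reachable⇒Covered : ∀ {n} {D : Subset n} {t} → Reachable (P n) D t → Covered (occupied D) (toℕ t)
Reachable⇒Covered (_ , moves , t∈D′) = Covered-before-moves moves (peg (∈⇒occupied t∈D′))

-- `scan f i` is the state after reading cells 0 … i-1: `owing` after a hole that the next cell has to
-- pay for, `paired` once the current stretch without adjacent holes contains two adjacent pegs.
-- `Budget σ k r` says k ≤ 2r for a prefix of length k with r pegs, with one unit of credit in
-- `paired` and one unit of debt in `owing`.
data Scan : Set where
  start owing single paired : Scan

next : Scan → Bool → Scan
next start  true  = single
next start  false = owing
next owing  true  = single
next owing  false = owing   -- never taken on covered cells, see budget-next
next single true  = paired
next single false = owing
next paired true  = paired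
next paired false = single

scan : (ℕ → Bool) → ℕ → Scan
scan f zero    = start
scan f (suc i) = next (scan f i) (f i)

pegsBelow : (ℕ → Bool) → ℕ → ℕ
pegsBelow f zero    = zero
pegsBelow f (suc i) = if f i then suc (pegsBelow f i) else pegsBelow f i

Budget : Scan → ℕ → ℕ → Set
Budget start  k r = k ≤ r + r
Budget owing  k r = k ≤ suc (r + r)
Budget single k r = k ≤ r + r
Budget paired k r = suc k ≤ r + r

budget-next : ∀ σ b {k r} → Budget σ k r → (σ ≡ owing → b ≡ true) →
              Budget (next σ b) (suc k) (if b then suc r else r)
budget-next start  true  {r = r} k≤2r _ rewrite +-suc r r = s≤s (m≤n⇒m≤1+n k≤2r)
budget-next start  false         k≤2r _ = s≤s k≤2r
budget-next owing  true  {r = r} k≤2r+1 _ rewrite +-suc r r = s≤s k≤2r+1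
budget-next owing  false         _ paid = contradiction (paid refl) λ ()
budget-next single true  {r = r} k≤2r _ rewrite +-suc r r = s≤s (s≤s k≤2r)
budget-next single false         k≤2r _ = s≤s k≤2r
budget-next paired true  {r = r} k<2r _ rewrite +-suc r r = s≤s (m≤n⇒m≤1+n k<2r)
budget-next paired false         k<2r _ = k<2r

Budget⇒k≤r+r : ∀ σ {k r} → σ ≢ owing → Budget σ k r → k ≤ r + r
Budget⇒k≤r+r start  _ k≤2r = k≤2r
Budget⇒k≤r+r owing  σ≢owing _ = contradiction refl σ≢owing
Budget⇒k≤r+r single _ k≤2r = k≤2r
Budget⇒k≤r+r paired _ k<2r = <⇒≤ k<2r

scan-budget : ∀ f k → (∀ i → i < k → scan f i ≡ owing → f i ≡ true) →
              Budget (scan f k) k (pegsBelow f k)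
scan-budget f zero    _    = z≤n
scan-budget f (suc k) paid =
  budget-next (scan f k) (f k) (scan-budget f k (λ i i<k → paid i (m<n⇒m<1+n i<k))) (paid k ≤-refl)

next-paired² : ∀ c c′ → c ≡ true ⊎ c′ ≡ true → next (next paired c) c′ ≡ next paired c′
next-paired² true  _     _          = refl
next-paired² false true  _          = refl
next-paired² false false (inj₁ ())
next-paired² false false (inj₂ ())

next-true² : ∀ σ → next (next σ true) true ≡ paired
next-true² start  = refl
next-true² owing  = refl
next-true² single = refl
next-true² paired = refl

next≡owing⇒false : ∀ σ b → next σ b ≡ owing → b ≡ false
next≡owing⇒false _      false _  = refl
next≡owing⇒false start  true  ()
next≡owing⇒false owing  true  ()
next≡owing⇒false single true  ()
next≡owing⇒false paired true  ()

scan-in-span : ∀ {f a b} (S : Span f a b) d → d + suc (Span.pair S) ≤ b →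
               scan f (suc (d + suc (Span.pair S))) ≡ next paired (f (d + suc (Span.pair S)))
scan-in-span {f} (span _ p _ _ fp fp′) zero _ rewrite fp | fp′ = next-true² (scan f p)
scan-in-span {f} {a} S@(span gl p a≤p _ _ _) (suc d) i<b =
  trans (cong (λ σ → next σ (f (suc i))) (scan-in-span S d (<⇒≤ i<b)))
        (next-paired² (f i) (f (suc i))
                      (gl i (≤-trans a≤p (≤-trans (n≤1+n p) (m≤n+m (suc p) d))) i<b))
  where
  i = d + suc p

scan-after-span : ∀ {f a b} → Span f a b → scan f (suc b) ≡ next paired (f b)
scan-after-span {f} {b = b} S@(span _ p _ p<b _ _) =
  subst (λ i → scan f (suc i) ≡ next paired (f i)) (m∸n+n≡m p<b)
        (scan-in-span S (b ∸ suc p) (≤-reflexive (m∸n+n≡m p<b)))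

Covered-hole² : ∀ {f y} → Covered f y → f y ≡ false → f (suc y) ≡ false → scan f (suc y) ≢ owing
Covered-hole² (peg fy) hole _ = ⊥-elim (peg≢hole fy hole)
Covered-hole² (spanned a≤y y≤b S) hole hole′ with m≤n⇒m<n∨m≡n y≤b
... | inj₁ y<b = ⊥-elim (Gapless-hole² (Span.gapless S) a≤y y<b hole hole′)
... | inj₂ refl rewrite scan-after-span S | hole = λ ()

Covered⇒paid : ∀ {f n} → (∀ y → y < n → Covered f y) →
               ∀ i → i ≤ n → scan f i ≡ owing → f i ≡ true
Covered⇒paid         cov zero    _   ()
Covered⇒paid {f} cov (suc y) y<n owe with f (suc y) in hole′
... | true  = refl
... | false = ⊥-elim (Covered-hole² (cov y y<n) (next≡owing⇒false (scan f y) (f y) owe) hole′ owe)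

pegsBelow-shift : ∀ f k → pegsBelow f (suc k) ≡ pegsBelow (f ∘ suc) k + pegsBelow f 1
pegsBelow-shift f zero    = refl
pegsBelow-shift f (suc k) with f (suc k)
... | true  = cong suc (pegsBelow-shift f k)
... | false = pegsBelow-shift f k

pegsBelow-occupied : ∀ {n} (p : Subset n) → pegsBelow (occupied p) n ≡ ∣ p ∣
pegsBelow-occupied         []          = refl
pegsBelow-occupied {suc n} (true ∷ p)  =
  trans (pegsBelow-shift (occupied (true ∷ p)) n)
        (trans (+-comm _ 1) (cong suc (pegsBelow-occupied p)))
pegsBelow-occupied {suc n} (false ∷ p) =
  trans (pegsBelow-shift (occupied (false ∷ p)) n)
        (trans (+-identityʳ _) (pegsBelow-occupied p))

Covered⇒n≤∣D∣+∣D∣ : ∀ {n} (D : Subset n) → (∀ y → y < n → Covered (occupied D) y) →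
                    n ≤ ∣ D ∣ + ∣ D ∣
Covered⇒n≤∣D∣+∣D∣ {n} D cov =
  subst (λ r → n ≤ r + r) (pegsBelow-occupied D)
        (Budget⇒k≤r+r (scan (occupied D) n) n-paid
                      (scan-budget (occupied D) n (λ i i<n → paid i (<⇒≤ i<n))))
  where
  paid = Covered⇒paid cov
  n-paid : scan (occupied D) n ≢ owing
  n-paid owe = peg≢hole (paid n ≤-refl owe) (occupied-beyond D ≤-refl)

FullReach⇒n≤∣D∣+∣D∣ : ∀ {n} (D : Subset n) → FullReach (P n) D → n ≤ ∣ D ∣ + ∣ D ∣
FullReach⇒n≤∣D∣+∣D∣ D full = Covered⇒n≤∣D∣+∣D∣ D λ y y<n →
  subst (Covered (occupied D)) (toℕ-fromℕ< y<n) (Reachable⇒Covered (full (fromℕ< y<n)))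

evens odds : ∀ k → Subset k
evens zero    = []
evens (suc k) = true ∷ odds k
odds zero     = []
odds (suc k)  = false ∷ evens k

∣evens∣ : ∀ k → ∣ evens k ∣ ≡ ⌈ k /2⌉
∣odds∣  : ∀ k → ∣ odds k ∣ ≡ ⌊ k /2⌋
∣evens∣ zero    = refl
∣evens∣ (suc k) = cong suc (∣odds∣ k)
∣odds∣ zero     = refl
∣odds∣ (suc k)  = ∣evens∣ k

evens-alternate : ∀ k i → suc i < k → occupied (evens k) (suc i) ≡ not (occupied (evens k) i)
odds-alternate  : ∀ k i → suc i < k → occupied (odds k) (suc i) ≡ not (occupied (odds k) i)
evens-alternate (suc zero)    zero    (s≤s ())
evens-alternate (suc (suc k)) zero    _         = refl
evens-alternate (suc k)       (suc i) (s≤s i+1<k) = odds-alternate k i i+1<k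
odds-alternate  (suc zero)    zero    (s≤s ())
odds-alternate  (suc (suc k)) zero    _         = refl
odds-alternate  (suc k)       (suc i) (s≤s i+1<k) = evens-alternate k i i+1<k

Reaches : ∀ {n} → Subset n → ℕ → Set
Reaches {n} X i = ∃ λ X′ → Moves (P n) X X′ × occupied X′ i ≡ true

jump-rightward : ∀ {n} (X : Subset n) a → suc (suc a) < n →
  occupied X a ≡ true → occupied X (suc a) ≡ true → occupied X (suc (suc a)) ≡ false →
  ∃ λ X′ → Move (P n) X X′ × occupied X′ (suc (suc a)) ≡ true ×
           (∀ i → suc (suc a) < i → occupied X′ i ≡ occupied X i)
jump-rightward {n} X a a+2<n Xa Xa+1 Xa+2 = jumped X u v w , move , landed , unchanged
  where
  a+1<n = <-trans (n<1+n _) a+2<n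
  u v w : Fin n
  u = fromℕ< (<-trans (n<1+n a) a+1<n)
  v = fromℕ< a+1<n
  w = fromℕ< a+2<n
  u≡a   = toℕ-fromℕ< (<-trans (n<1+n a) a+1<n)
  v≡a+1 = toℕ-fromℕ< a+1<n
  w≡a+2 = toℕ-fromℕ< a+2<n
  move : Move (P n) X (jumped X u v w)
  move = jump u v w
    (occupied⇒∈ u X (trans (cong (occupied X) u≡a) Xa))
    (occupied⇒∈ v X (trans (cong (occupied X) v≡a+1) Xa+1))
    (λ u≡v → 1+n≢n (sym (trans (sym u≡a) (trans (cong toℕ u≡v) v≡a+1))))
    (inj₁ (trans (cong suc u≡a) (sym v≡a+1)))
    (λ w∈X → peg≢hole (trans (sym (cong (occupied X) w≡a+2)) (∈⇒occupied w∈X)) Xa+2)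
    (inj₁ (trans (cong suc v≡a+1) (sym w≡a+2)))
  landed : occupied (jumped X u v w) (suc (suc a)) ≡ true
  landed = subst (λ j → occupied (jumped X u v w) j ≡ true) w≡a+2 (occupied-jumped-target X u v w)
  unchanged : ∀ i → suc (suc a) < i → occupied (jumped X u v w) i ≡ occupied X i
  unchanged i a+2<i = occupied-jumped-other X u v w (beyond u≡a (≤-trans (n≤1+n a) (n≤1+n _)))
                                                  (beyond v≡a+1 (n≤1+n _)) (beyond w≡a+2 ≤-refl)
    where
    beyond : ∀ {x j} → toℕ x ≡ j → j ≤ suc (suc a) → i ≢ toℕ x
    beyond x≡j j≤a+2 i≡x = <⇒≱ a+2<i (subst (_≤ suc (suc a)) (sym (trans i≡x x≡j)) j≤a+2)

Reaches-step : ∀ {n} {X X′ : Subset n} {i} → Move (P n) X X′ → Reaches X′ i → Reaches X i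
Reaches-step move (Y , moves , Yi) = Y , move ◅ moves , Yi

leapfrog : ∀ {n} (X : Subset n) {a t} d → d + a ≡ t → t < n →
        occupied X a ≡ true → occupied X (suc a) ≡ true →
        (∀ i → suc a ≤ i → i < t → occupied X (suc i) ≡ not (occupied X i)) → Reaches X t
leapfrog X zero       refl _ Xa _    _ = X , ε , Xa
leapfrog X (suc zero) refl _ _  Xa+1 _ = X , ε , Xa+1
leapfrog X {a} (suc (suc d)) refl t<n Xa Xa+1 alt
  with jump-rightward X a (≤-<-trans (s≤s (s≤s (m≤n+m a d))) t<n) Xa Xa+1 Xa+2
  where
  Xa+2 : occupied X (suc (suc a)) ≡ false
  Xa+2 = trans (alt (suc a) ≤-refl (s≤s (s≤s (m≤n+m a d)))) (cong not Xa+1)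
leapfrog X (suc (suc zero))    refl _   _ _ _ | X′ , move , X′a+2 , _ = X′ , move ◅ ε , X′a+2
leapfrog X {a} (suc (suc (suc d))) refl t<n _ Xa+1 alt | X′ , move , X′a+2 , unchanged =
  Reaches-step move (leapfrog X′ (suc d) (cong suc (trans (+-suc d (suc a)) (cong suc (+-suc d a))))
                          t<n X′a+2 X′a+3 alt′)
  where
  alt′ : ∀ i → suc (suc (suc a)) ≤ i → i < suc (suc (suc (d + a))) →
         occupied X′ (suc i) ≡ not (occupied X′ i)
  alt′ i a+3≤i i<t = begin
    occupied X′ (suc i)   ≡⟨ unchanged (suc i) (m≤n⇒m≤1+n a+3≤i) ⟩
    occupied X (suc i)    ≡⟨ alt i (≤-trans (n≤1+n _) (≤-trans (n≤1+n _) a+3≤i)) i<t ⟩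
    not (occupied X i)    ≡⟨ cong not (unchanged i a+3≤i) ⟨
    not (occupied X′ i)   ∎
    where open ≡-Reasoning
  X′a+3 : occupied X′ (suc (suc (suc a))) ≡ true
  X′a+3 = begin
    occupied X′ (suc (suc (suc a)))   ≡⟨ unchanged _ ≤-refl ⟩
    occupied X (suc (suc (suc a)))    ≡⟨ alt (suc (suc a)) (n≤1+n _) (s≤s (s≤s (s≤s (m≤n+m a d)))) ⟩
    not (occupied X (suc (suc a)))    ≡⟨ cong not (alt (suc a) ≤-refl (s≤s (s≤s (m≤n+m a (suc d))))) ⟩
    not (not (occupied X (suc a)))    ≡⟨ cong (not ∘ not) Xa+1 ⟩
    true                              ∎
    where open ≡-Reasoning

oneAndEvens : ∀ m → Subset (3 + m)
oneAndEvens m = false ∷ true ∷ evens (suc m)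

∣oneAndEvens∣ : ∀ m → ∣ oneAndEvens m ∣ ≡ ⌈ 3 + m /2⌉
∣oneAndEvens∣ m = cong suc (∣evens∣ (suc m))

oneAndEvens-fullReach : ∀ m → FullReach (P (3 + m)) (oneAndEvens m)
oneAndEvens-fullReach m fzero =
  _ , jump two one fzero (there (there here)) (there here) (λ ()) (inj₂ refl) (λ ()) (inj₂ refl) ◅ ε
  , here
  where
  one two : Fin (3 + m)
  one = fsuc fzero
  two = fsuc (fsuc fzero)
oneAndEvens-fullReach m (fsuc t)
  with leapfrog (oneAndEvens m) (toℕ t) (+-comm (toℕ t) 1) (s≤s (toℕ<n t)) refl refl alternates
  where
  alternates : ∀ i → 2 ≤ i → i < suc (toℕ t) →
               occupied (oneAndEvens m) (suc i) ≡ not (occupied (oneAndEvens m) i)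
  alternates (suc zero)    (s≤s ())
  alternates (suc (suc i)) _ i<t =
    evens-alternate (suc m) i (≤-trans (s≤s⁻¹ i<t) (s≤s⁻¹ (toℕ<n t)))
... | X , moves , Xt = X , moves , occupied⇒∈ (fsuc t) X Xt

n≤d+d⇒⌈n/2⌉≤d : ∀ {n d} → n ≤ d + d → ⌈ n /2⌉ ≤ d
n≤d+d⇒⌈n/2⌉≤d {d = d} n≤2d = ≤-trans (⌈n/2⌉-mono n≤2d) (≤-reflexive (sym (n≡⌈n+n/2⌉ d)))

theorem3p5 : (n : ℕ) → 3 ≤ n → IsOptimalPeggingNumber (P n) ⌈ n /2⌉
theorem3p5 (suc (suc (suc m))) (s≤s (s≤s (s≤s z≤n))) =
    s≤s z≤n
  , (oneAndEvens m , ∣oneAndEvens∣ m , oneAndEvens-fullReach m)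
  , λ d _ d<⌈n/2⌉ D ∣D∣≡d full →
      <⇒≱ d<⌈n/2⌉ (n≤d+d⇒⌈n/2⌉≤d (subst (λ r → 3 + m ≤ r + r) ∣D∣≡d
                                        (FullReach⇒n≤∣D∣+∣D∣ D full)))
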